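{- Let $t\ge 3$, $k\ge 3$ and $n\ge k$ be integers. Then every $n$-vertex linear $k$-uniform hypergraph that is linear Berge-$C_t$-saturated has at least $\big\lfloor\frac{n-1}{k-1}\big\rfloor$ hyperedges; that is, $$\mathrm{sat}^{lin}_k(n,\text{Berge- }C_t)\ge \bigg\lfloor\frac{n-1}{k-1}\bigg\rfloor.$$
   Context: A hypergraph $H=(V(H),E(H))$ is $k$-uniform if every hyperedge is a $k$-element subset of $V(H)$, and linear if any two distinct hyperedges share at most one vertex. A Berge cycle Berge-$C_\ell$ of length $\ell$ in $H$ is an alternating sequence $(v_1,e_1,v_2,e_2,\dots,v_\ell,e_\ell)$ of distinct vertices $v_i$ and distinct hyperedges $e_i$ of $H$ with $v_i,v_{i+1}\in e_i$ for $1\le i\le \ell-1$ and $v_\ell,v_1\in e_\ell$. A linear $k$-uniform hypergraph $H$ is linear Berge-$C_t$-saturated if $H$ contains no Berge-$C_t$, but for every $e\in\binom{V(H)}{k}\setminus E(H)$ such that $H+e$ is still linear, $H+e$ contains a Berge-$C_t$. The linear saturation number $\mathrm{sat}^{lin}_k(n,\text{Berge- }C_t)$ is the minimum number of hyperedges of an $n$-vertex linear $k$-uniform hypergraph that is linear Berge-$C_t$-saturated. -}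

module Defs where

open import Data.Nat using (ℕ; zero; suc; _≤_; _/_; _%_)
open import Data.Nat.DivMod using (m%n<n)
open import Data.Fin using (Fin; toℕ; fromℕ<)
import Data.Fin as F
open import Data.Fin.Subset using (Subset; _∈_; _∩_; ∣_∣)
open import Data.Product using (Σ; _×_)
open import Function.Definitions using (Injective)
open import Relation.Binary.PropositionalEquality using (_≡_; _≢_)

-- A hypergraph on vertex set Fin n with m hyperedges, given as an
-- injective (distinct hyperedges) family E : Fin m → Subset n.

Uniform : ∀ {n m} → ℕ → (Fin m → Subset n) → Set
Uniform k E = ∀ i → ∣ E i ∣ ≡ k

Linear : ∀ {n m} → (Fin m → Subset n) → Set
Linear E = ∀ i j → i ≢ j → ∣ E i ∩ E j ∣ ≤ 1

IsLinearUniform : ∀ {n m} → ℕ → (Fin m → Subset n) → Set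
IsLinearUniform k E = Injective _≡_ _≡_ E × Uniform k E × Linear E

next : ∀ {ℓ} → Fin (suc ℓ) → Fin (suc ℓ)
next {ℓ} i = fromℕ< (m%n<n (suc (toℕ i)) (suc ℓ))

HasBergeCycle : ∀ {n m} → (ℓ : ℕ) → (Fin m → Subset n) → Set
HasBergeCycle {n} {m} ℓ E =
  Σ (Fin (suc ℓ) → Fin n) λ v →
  Σ (Fin (suc ℓ) → Fin m) λ e →
    Injective _≡_ _≡_ v × Injective _≡_ _≡_ e ×
    (∀ i → (v i ∈ E (e i)) × (v (next i) ∈ E (e i)))

addEdge : ∀ {n m} → (Fin m → Subset n) → Subset n → Fin (suc m) → Subset n
addEdge E f F.zero    = f
addEdge E f (F.suc i) = E i

LinearBergeSaturated : ∀ {n m} → (k ℓ : ℕ) → (Fin m → Subset n) → Set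
LinearBergeSaturated k ℓ E =
  (HasBergeCycle ℓ E → Data.Empty.⊥) ×
  (∀ (f : Subset _) → ∣ f ∣ ≡ k → (∀ i → E i ≢ f) →
     Linear (addEdge E f) → HasBergeCycle ℓ (addEdge E f))
  where import Data.Empty

-- floor division, with the convention a / 0 = 0 (never used at 0 here)
_div_ : ℕ → ℕ → ℕ
a div zero    = 0
a div (suc b) = a / suc b

{-# OPTIONS --safe #-}
-- If m < ⌊(n−1)/(k−1)⌋ then n ≥ k + m(k−1). Adding the hyperedges one at a time, a hyperedge
-- with k vertices merges at most k connected components into one, so H has at least
-- n − m(k−1) ≥ k components. A k-set f taking one vertex from each of k components meets every
-- hyperedge in at most one vertex, so f is not a hyperedge and H + f is linear; by saturation
-- H + f contains a Berge cycle, necessarily through f. The rest of that cycle is a walk in H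
-- joining two distinct vertices of f, which lie in different components: a contradiction.
module Submission where

open import Defs
open import Data.Nat using (ℕ; zero; suc; _+_; _*_; _∸_; _≤_; _<_; _%_; _/_; z≤n; s≤s; _≤?_)
open import Data.Nat.Properties
  using (≤-refl; ≤-trans; ≤-reflexive; <⇒≤; <⇒≱; ≰⇒>; ≤-pred; n≤1+n; +-identityʳ; +-suc; +-assoc;
         +-cancelˡ-≡; +-cancelʳ-≤; +-monoˡ-≤; +-monoʳ-≤; *-monoˡ-≤)
open import Data.Nat.DivMod using (m<n⇒m%n≡m; m%n%n≡m%n; %-distribˡ-+; [m+n]%n≡m%n; m≡m%n+[m/n]*n; m/n*n≤m)
open import Data.Nat.Divisibility using (divides; ∣⇒≤)
open import Data.Nat.GeneralisedArithmetic using (fold)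
open import Data.Fin using (Fin; zero; suc; toℕ; punchOut)
open import Data.Fin.Properties using (_≟_; any?; toℕ-fromℕ<; toℕ-injective; toℕ<n; punchOut-injective; punchIn-punchOut)
open import Data.Fin.Subset
  using (Subset; inside; outside; _∈_; _∉_; _⊆_; _∩_; _∪_; _─_; _⊂_; ⊥; ⊤; ⁅_⁆; ∣_∣; Nonempty)
open import Data.Fin.Subset.Properties
  using (_∈?_; nonempty?; Empty-unique; ⊥⊆; ∣⊥∣≡0; ∣⊤∣≡n; x∈⁅x⁆; ∣⁅x⁆∣≡1; p⊆q⇒∣p∣≤∣q∣; p⊂q⇒∣p∣<∣q∣;
         x∈p∪q⁺; x∈p∩q⁻; ∩-comm; ∩-idem; p─q⊆p; x∈p∧x∉q⇒x∈p─q)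
open import Data.Vec using (_∷_; []; here; there; tabulate)
open import Data.Vec.Properties using (lookup∘tabulate; []=⇒lookup; lookup⇒[]=)
open import Data.Product using (∃; _×_; _,_; proj₁; proj₂)
open import Data.Sum using (inj₁; inj₂)
open import Function using (_∘_; id; Injective)
open import Relation.Nullary using (¬_; Dec; yes; no; does; contradiction)
open import Relation.Nullary.Decidable using (dec-true)
open import Relation.Binary.PropositionalEquality using (_≡_; _≢_; refl; sym; trans; cong; subst; module ≡-Reasoning)

next^ : ∀ {ℓ} → ℕ → Fin (suc ℓ) → Fin (suc ℓ)
next^ s i = fold i next s

[1+m%n]%n≡[1+m]%n : ∀ m n → suc (m % suc n) % suc n ≡ suc m % suc n
[1+m%n]%n≡[1+m]%n m n = begin
  (1 + m % N) % N           ≡⟨ %-distribˡ-+ 1 (m % N) N ⟩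
  (1 % N + m % N % N) % N   ≡⟨ cong (λ a → (1 % N + a) % N) (m%n%n≡m%n m N) ⟩
  (1 % N + m % N) % N       ≡⟨ sym (%-distribˡ-+ 1 m N) ⟩
  (1 + m) % N               ∎
  where
  open ≡-Reasoning
  N : ℕ
  N = suc n

toℕ-next^ : ∀ {ℓ} (i : Fin (suc ℓ)) s → toℕ (next^ s i) ≡ (toℕ i + s) % suc ℓ
toℕ-next^ {ℓ} i zero = begin
  toℕ i                 ≡⟨ sym (m<n⇒m%n≡m (toℕ<n i)) ⟩
  toℕ i % suc ℓ         ≡⟨ cong (_% suc ℓ) (sym (+-identityʳ (toℕ i))) ⟩
  (toℕ i + 0) % suc ℓ   ∎
  where open ≡-Reasoning
toℕ-next^ {ℓ} i (suc s) = begin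
  toℕ (next (next^ s i))            ≡⟨ toℕ-fromℕ< _ ⟩
  suc (toℕ (next^ s i)) % suc ℓ     ≡⟨ cong (λ a → suc a % suc ℓ) (toℕ-next^ i s) ⟩
  suc ((toℕ i + s) % suc ℓ) % suc ℓ ≡⟨ [1+m%n]%n≡[1+m]%n (toℕ i + s) ℓ ⟩
  suc (toℕ i + s) % suc ℓ           ≡⟨ cong (_% suc ℓ) (sym (+-suc (toℕ i) s)) ⟩
  (toℕ i + suc s) % suc ℓ           ∎
  where open ≡-Reasoning

next^-period : ∀ {ℓ} (i : Fin (suc ℓ)) → next^ (suc ℓ) i ≡ i
next^-period {ℓ} i = toℕ-injective (begin
  toℕ (next^ (suc ℓ) i)   ≡⟨ toℕ-next^ i (suc ℓ) ⟩
  (toℕ i + suc ℓ) % suc ℓ ≡⟨ [m+n]%n≡m%n (toℕ i) (suc ℓ) ⟩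
  toℕ i % suc ℓ           ≡⟨ m<n⇒m%n≡m (toℕ<n i) ⟩
  toℕ i                   ∎)
  where open ≡-Reasoning

-- Returning to i after suc s steps would make suc s a multiple of the cycle length.
next^-≢ : ∀ {ℓ} (i : Fin (suc ℓ)) s → s < ℓ → next^ (suc s) i ≢ i
next^-≢ {ℓ} i s s<ℓ returns = <⇒≱ (s≤s s<ℓ) (∣⇒≤ (divides q (+-cancelˡ-≡ (toℕ i) _ _ i+s≡i+q*N)))
  where
  open ≡-Reasoning
  q : ℕ
  q = (toℕ i + suc s) / suc ℓ
  i+s≡i+q*N : toℕ i + suc s ≡ toℕ i + q * suc ℓ
  i+s≡i+q*N = begin
    toℕ i + suc s                       ≡⟨ m≡m%n+[m/n]*n (toℕ i + suc s) (suc ℓ) ⟩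
    (toℕ i + suc s) % suc ℓ + q * suc ℓ ≡⟨ cong (_+ q * suc ℓ) (sym (toℕ-next^ i (suc s))) ⟩
    toℕ (next^ (suc s) i) + q * suc ℓ   ≡⟨ cong (λ j → toℕ j + q * suc ℓ) returns ⟩
    toℕ i + q * suc ℓ                   ∎

next≢ : ∀ {ℓ} → 0 < ℓ → (i : Fin (suc ℓ)) → next i ≢ i
next≢ 0<ℓ i = next^-≢ i 0 0<ℓ

module _ {a} {A : Set a} {ℓ} (h : Fin (suc ℓ) → A) (i : Fin (suc ℓ))
         (step : ∀ j → j ≢ i → h (next j) ≡ h j) where

  private
    walk : ∀ s → s ≤ ℓ → h (next^ (suc s) i) ≡ h (next i)
    walk zero    _   = refl
    walk (suc s) s<ℓ = trans (step _ (next^-≢ i s s<ℓ)) (walk s (<⇒≤ s<ℓ))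

  cyclic-invariance : h (next i) ≡ h i
  cyclic-invariance = trans (sym (walk ℓ ≤-refl)) (cong h (next^-period i))

∣p∪q∣≤∣p∣+∣q∣ : ∀ {n} (p q : Subset n) → ∣ p ∪ q ∣ ≤ ∣ p ∣ + ∣ q ∣
∣p∪q∣≤∣p∣+∣q∣ []            []            = z≤n
∣p∪q∣≤∣p∣+∣q∣ (outside ∷ p) (outside ∷ q) = ∣p∪q∣≤∣p∣+∣q∣ p q
∣p∪q∣≤∣p∣+∣q∣ (inside  ∷ p) (outside ∷ q) = s≤s (∣p∪q∣≤∣p∣+∣q∣ p q)
∣p∪q∣≤∣p∣+∣q∣ (outside ∷ p) (inside  ∷ q) = ≤-trans (s≤s (∣p∪q∣≤∣p∣+∣q∣ p q)) (≤-reflexive (sym (+-suc ∣ p ∣ ∣ q ∣)))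
∣p∪q∣≤∣p∣+∣q∣ (inside  ∷ p) (inside  ∷ q) = s≤s (≤-trans (∣p∪q∣≤∣p∣+∣q∣ p q) (+-monoʳ-≤ ∣ p ∣ (n≤1+n ∣ q ∣)))

x∈p─q⇒x∉q : ∀ {n} {x : Fin n} (p q : Subset n) → x ∈ p ─ q → x ∉ q
x∈p─q⇒x∉q (inside ∷ p) (outside ∷ q) here       ()
x∈p─q⇒x∉q (_      ∷ p) (_       ∷ q) (there x∈) (there x∈q) = x∈p─q⇒x∉q p q x∈ x∈q

∣p∣>0⇒Nonempty : ∀ {n} (p : Subset n) → 0 < ∣ p ∣ → Nonempty p
∣p∣>0⇒Nonempty {n} p 0<∣p∣ with nonempty? p
... | yes ne    = ne
... | no  empty = contradiction (trans (cong ∣_∣ (Empty-unique empty)) (∣⊥∣≡0 n)) λ ∣p∣≡0 → <⇒≱ 0<∣p∣ (≤-reflexive ∣p∣≡0)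

subsingleton⇒∣p∣≤1 : ∀ {n} (p : Subset n) → (∀ {x y} → x ∈ p → y ∈ p → x ≡ y) → ∣ p ∣ ≤ 1
subsingleton⇒∣p∣≤1 {n} p unique with nonempty? p
... | yes (x , x∈p) = subst (∣ p ∣ ≤_) (∣⁅x⁆∣≡1 x) (p⊆q⇒∣p∣≤∣q∣ λ y∈p → subst (_∈ ⁅ x ⁆) (unique x∈p y∈p) (x∈⁅x⁆ x))
... | no  empty     = ≤-trans (≤-reflexive (trans (cong ∣_∣ (Empty-unique empty)) (∣⊥∣≡0 n))) z≤n

⊆-of-size : ∀ {n} k (p : Subset n) → k ≤ ∣ p ∣ → ∃ λ q → q ⊆ p × ∣ q ∣ ≡ k
⊆-of-size {n} zero p _ = ⊥ , ⊥⊆ , ∣⊥∣≡0 n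
⊆-of-size (suc k) (outside ∷ p) k<∣p∣ with ⊆-of-size (suc k) p k<∣p∣
... | q , q⊆p , ∣q∣≡k = outside ∷ q , (λ { (there x∈q) → there (q⊆p x∈q) }) , ∣q∣≡k
⊆-of-size (suc k) (inside ∷ p) (s≤s k≤∣p∣) with ⊆-of-size k p k≤∣p∣
... | q , q⊆p , ∣q∣≡k = inside ∷ q , (λ { here → here ; (there x∈q) → there (q⊆p x∈q) }) , cong suc ∣q∣≡k

image : ∀ {n N} → (Fin n → Fin N) → Subset n → Subset N
image g []            = ⊥
image g (outside ∷ p) = image (g ∘ suc) p
image g (inside  ∷ p) = ⁅ g zero ⁆ ∪ image (g ∘ suc) p

∈-image⁺ : ∀ {n N} (g : Fin n → Fin N) p {x} → x ∈ p → g x ∈ image g p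
∈-image⁺ g (inside  ∷ p) here        = x∈p∪q⁺ (inj₁ (x∈⁅x⁆ (g zero)))
∈-image⁺ g (inside  ∷ p) (there x∈p) = x∈p∪q⁺ (inj₂ (∈-image⁺ (g ∘ suc) p x∈p))
∈-image⁺ g (outside ∷ p) (there x∈p) = ∈-image⁺ (g ∘ suc) p x∈p

∣image∣≤∣p∣ : ∀ {n N} (g : Fin n → Fin N) p → ∣ image g p ∣ ≤ ∣ p ∣
∣image∣≤∣p∣ {N = N} g [] = ≤-reflexive (∣⊥∣≡0 N)
∣image∣≤∣p∣ g (outside ∷ p) = ∣image∣≤∣p∣ (g ∘ suc) p
∣image∣≤∣p∣ g (inside  ∷ p) = begin
  ∣ ⁅ g zero ⁆ ∪ image (g ∘ suc) p ∣     ≤⟨ ∣p∪q∣≤∣p∣+∣q∣ ⁅ g zero ⁆ _ ⟩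
  ∣ ⁅ g zero ⁆ ∣ + ∣ image (g ∘ suc) p ∣ ≡⟨ cong (_+ ∣ image (g ∘ suc) p ∣) (∣⁅x⁆∣≡1 (g zero)) ⟩
  suc ∣ image (g ∘ suc) p ∣              ≤⟨ s≤s (∣image∣≤∣p∣ (g ∘ suc) p) ⟩
  suc ∣ p ∣                              ∎
  where open Data.Nat.Properties.≤-Reasoning

fixedPoints : ∀ {n} → (Fin n → Fin n) → Subset n
fixedPoints g = tabulate λ x → does (g x ≟ x)

∈-fixedPoints⁺ : ∀ {n} (g : Fin n → Fin n) {x} → g x ≡ x → x ∈ fixedPoints g
∈-fixedPoints⁺ g {x} gx≡x = lookup⇒[]= x _ (trans (lookup∘tabulate _ x) (dec-true (g x ≟ x) gx≡x))

∈-fixedPoints⁻ : ∀ {n} (g : Fin n → Fin n) {x} → x ∈ fixedPoints g → g x ≡ x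
∈-fixedPoints⁻ g {x} x∈ with g x ≟ x | trans (sym (lookup∘tabulate _ x)) ([]=⇒lookup x∈)
... | yes gx≡x | _ = gx≡x

-- Representatives of connected components

ConstantOn : ∀ {n b} {B : Set b} → (Fin n → B) → Subset n → Set b
ConstantOn g p = ∀ {x y} → x ∈ p → y ∈ p → g x ≡ g y

InjectiveOn : ∀ {n b} {B : Set b} → (Fin n → B) → Subset n → Set b
InjectiveOn g p = ∀ {x y} → x ∈ p → y ∈ p → g x ≡ g y → x ≡ y

∣constant∩injective∣≤1 : ∀ {n b} {B : Set b} (g : Fin n → B) {p q : Subset n} →
  ConstantOn g p → InjectiveOn g q → ∣ p ∩ q ∣ ≤ 1
∣constant∩injective∣≤1 g {p} {q} const inj = subsingleton⇒∣p∣≤1 (p ∩ q) λ x∈ y∈ →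
  let x∈p , x∈q = x∈p∩q⁻ p q x∈
      y∈p , y∈q = x∈p∩q⁻ p q y∈
  in inj x∈q y∈q (const x∈p y∈p)

module Redirect {n} (g : Fin n → Fin n) (g-idem : ∀ x → g (g x) ≡ g x)
                (R : Subset n) (r : Fin n) (r∈R : r ∈ R) (gr≡r : g r ≡ r) where

  redirect : Fin n → Fin n
  redirect y with y ∈? R
  ... | yes _ = r
  ... | no  _ = y

  redirect-∈ : ∀ {y} → y ∈ R → redirect y ≡ r
  redirect-∈ {y} y∈R with y ∈? R
  ... | yes _   = refl
  ... | no  y∉R = contradiction y∈R y∉R

  redirect-∉ : ∀ {y} → y ∉ R → redirect y ≡ y
  redirect-∉ {y} y∉R with y ∈? R
  ... | yes y∈R = contradiction y∈R y∉R
  ... | no  _   = refl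

  merged : Fin n → Fin n
  merged = redirect ∘ g

  merged-idem : ∀ x → merged (merged x) ≡ merged x
  merged-idem x = by-cases (g x ∈? R)
    where
    open ≡-Reasoning
    by-cases : Dec (g x ∈ R) → merged (merged x) ≡ merged x
    by-cases (yes gx∈R) = begin
      merged (merged x)  ≡⟨ cong merged (redirect-∈ gx∈R) ⟩
      redirect (g r)     ≡⟨ cong redirect gr≡r ⟩
      redirect r         ≡⟨ redirect-∈ r∈R ⟩
      r                  ≡⟨ sym (redirect-∈ gx∈R) ⟩
      merged x           ∎
    by-cases (no gx∉R) = begin
      merged (merged x)  ≡⟨ cong merged (redirect-∉ gx∉R) ⟩
      redirect (g (g x)) ≡⟨ cong redirect (g-idem x) ⟩
      merged x           ∎

  -- Only the points of R stop being fixed, and r becomes fixed again.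
  ∣fixedPoints-merged∣ : suc ∣ fixedPoints g ∣ ≤ ∣ fixedPoints merged ∣ + ∣ R ∣
  ∣fixedPoints-merged∣ = begin
    suc ∣ fixedPoints g ∣             ≤⟨ s≤s (p⊆q⇒∣p∣≤∣q∣ cover) ⟩
    suc ∣ kept ∪ R ∣                  ≤⟨ s≤s (∣p∪q∣≤∣p∣+∣q∣ kept R) ⟩
    suc ∣ kept ∣ + ∣ R ∣              ≤⟨ +-monoˡ-≤ ∣ R ∣ (p⊂q⇒∣p∣<∣q∣ kept⊂) ⟩
    ∣ fixedPoints merged ∣ + ∣ R ∣    ∎
    where
    open Data.Nat.Properties.≤-Reasoning
    kept : Subset n
    kept = fixedPoints g ─ R
    cover : fixedPoints g ⊆ kept ∪ R
    cover {x} x∈ with x ∈? R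
    ... | yes x∈R = x∈p∪q⁺ (inj₂ x∈R)
    ... | no  x∉R = x∈p∪q⁺ (inj₁ (x∈p∧x∉q⇒x∈p─q x∈ x∉R))
    kept⊆ : kept ⊆ fixedPoints merged
    kept⊆ {x} x∈ = ∈-fixedPoints⁺ merged (trans (cong redirect gx≡x) (redirect-∉ (x∈p─q⇒x∉q _ R x∈)))
      where
      gx≡x : g x ≡ x
      gx≡x = ∈-fixedPoints⁻ g (p─q⊆p _ R x∈)
    kept⊂ : kept ⊂ fixedPoints merged
    kept⊂ = kept⊆ , r , ∈-fixedPoints⁺ merged (trans (cong redirect gr≡r) (redirect-∈ r∈R)) , λ r∈ → x∈p─q⇒x∉q _ R r∈ r∈R

injectiveOn-fixedPoints : ∀ {n} (g : Fin n → Fin n) → InjectiveOn g (fixedPoints g)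
injectiveOn-fixedPoints g x∈ y∈ gx≡gy = trans (sym (∈-fixedPoints⁻ g x∈)) (trans gx≡gy (∈-fixedPoints⁻ g y∈))

record Representatives {n m} (d : ℕ) (E : Fin m → Subset n) : Set where
  field
    rep       : Fin n → Fin n
    rep-idem  : ∀ x → rep (rep x) ≡ rep x
    rep-edges : ∀ j → ConstantOn rep (E j)
    many-reps : n ≤ ∣ fixedPoints rep ∣ + m * d

representatives : ∀ {n m d} (E : Fin m → Subset n) → (∀ j → ∣ E j ∣ ≡ suc d) → Representatives d E
representatives {n} {zero} E _ = record
  { rep       = id
  ; rep-idem  = λ _ → refl
  ; rep-edges = λ ()
  ; many-reps = begin
      n                           ≡⟨ sym (∣⊤∣≡n n) ⟩
      ∣ ⊤ {n} ∣                   ≤⟨ p⊆q⇒∣p∣≤∣q∣ {p = ⊤ {n}} {q = fixedPoints id} (λ _ → ∈-fixedPoints⁺ id refl) ⟩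
      ∣ fixedPoints {n} id ∣      ≡⟨ sym (+-identityʳ _) ⟩
      ∣ fixedPoints {n} id ∣ + 0  ∎
  }
  where open Data.Nat.Properties.≤-Reasoning
representatives {n} {suc m} {d} E uniform = record
  { rep       = merged
  ; rep-idem  = merged-idem
  ; rep-edges = λ where
      zero    x∈e y∈e → trans (redirect-∈ (∈-image⁺ rep e x∈e)) (sym (redirect-∈ (∈-image⁺ rep e y∈e)))
      (suc j) x∈ y∈   → cong redirect (rep-edges j x∈ y∈)
  ; many-reps = begin
      n                                          ≤⟨ many-reps ⟩
      ∣ fixedPoints rep ∣ + m * d                ≤⟨ +-monoˡ-≤ (m * d) fewer-reps ⟩
      ∣ fixedPoints merged ∣ + d + m * d         ≡⟨ +-assoc ∣ fixedPoints merged ∣ d (m * d) ⟩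
      ∣ fixedPoints merged ∣ + suc m * d         ∎
  }
  where
  open Representatives (representatives (E ∘ suc) (uniform ∘ suc))
  e : Subset n
  e = E zero
  x₀∈e : Nonempty e
  x₀∈e = ∣p∣>0⇒Nonempty e (≤-trans (s≤s z≤n) (≤-reflexive (sym (uniform zero))))
  open Redirect rep rep-idem (image rep e) (rep (proj₁ x₀∈e)) (∈-image⁺ rep e (proj₂ x₀∈e)) (rep-idem _)
  open Data.Nat.Properties.≤-Reasoning
  fewer-reps : ∣ fixedPoints rep ∣ ≤ ∣ fixedPoints merged ∣ + d
  fewer-reps = ≤-pred (begin
    suc ∣ fixedPoints rep ∣                      ≤⟨ ∣fixedPoints-merged∣ ⟩
    ∣ fixedPoints merged ∣ + ∣ image rep e ∣     ≤⟨ +-monoʳ-≤ ∣ fixedPoints merged ∣ (∣image∣≤∣p∣ rep e) ⟩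
    ∣ fixedPoints merged ∣ + ∣ e ∣               ≡⟨ cong (∣ fixedPoints merged ∣ +_) (uniform zero) ⟩
    ∣ fixedPoints merged ∣ + suc d               ≡⟨ +-suc _ d ⟩
    suc (∣ fixedPoints merged ∣ + d)             ∎)

transversal : ∀ {n m d} (E : Fin m → Subset n) → (∀ j → ∣ E j ∣ ≡ suc d) → suc d + m * d ≤ n →
  ∃ λ (g : Fin n → Fin n) → ∃ λ f → ∣ f ∣ ≡ suc d × (∀ j → ConstantOn g (E j)) × InjectiveOn g f
transversal {m = m} {d} E uniform room =
  let open Representatives (representatives E uniform)
      f , f⊆reps , ∣f∣≡k = ⊆-of-size (suc d) (fixedPoints rep) (+-cancelʳ-≤ (m * d) (suc d) _ (≤-trans room many-reps))
  in rep , f , ∣f∣≡k , rep-edges , λ x∈f y∈f → injectiveOn-fixedPoints rep (f⊆reps x∈f) (f⊆reps y∈f)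

IsBergeCycle : ∀ {n m} ℓ → (Fin m → Subset n) → (Fin (suc ℓ) → Fin n) → (Fin (suc ℓ) → Fin m) → Set
IsBergeCycle ℓ E v e = Injective _≡_ _≡_ v × Injective _≡_ _≡_ e × (∀ i → v i ∈ E (e i) × v (next i) ∈ E (e i))

module _ {n m ℓ} {E : Fin m → Subset n} {f : Subset n}
         {v : Fin (suc ℓ) → Fin n} {e : Fin (suc ℓ) → Fin (suc m)} where

  BergeCycle-avoiding-new-edge : IsBergeCycle ℓ (addEdge E f) v e → (∀ i → zero ≢ e i) → HasBergeCycle ℓ E
  BergeCycle-avoiding-new-edge (v-inj , e-inj , v∈e) e≢0 = v , old , v-inj , old-inj , v∈old
    where
    old : Fin (suc ℓ) → Fin m
    old i = punchOut (e≢0 i)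
    old-inj : Injective _≡_ _≡_ old
    old-inj eq = e-inj (punchOut-injective (e≢0 _) (e≢0 _) eq)
    v∈old : ∀ i → v i ∈ E (old i) × v (next i) ∈ E (old i)
    v∈old i = subst (λ c → v i ∈ addEdge E f c × v (next i) ∈ addEdge E f c) (sym (punchIn-punchOut (e≢0 i))) (v∈e i)

  -- The rest of the cycle is a walk in E, along which g is constant; it joins the two ends of the new edge.
  BergeCycle-through-new-edge : ∀ {b} {B : Set b} (g : Fin n → B) → (∀ j → ConstantOn g (E j)) → InjectiveOn g f →
    IsBergeCycle ℓ (addEdge E f) v e → ∀ i → e i ≡ zero → v (next i) ≡ v i
  BergeCycle-through-new-edge g g-edges g-f (_ , e-inj , v∈e) i eᵢ≡0 =
    g-f (in-f (proj₂ (v∈e i))) (in-f (proj₁ (v∈e i))) (cyclic-invariance (g ∘ v) i step)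
    where
    in-f : ∀ {x} → x ∈ addEdge E f (e i) → x ∈ f
    in-f = subst (λ c → _ ∈ addEdge E f c) eᵢ≡0
    step : ∀ j → j ≢ i → g (v (next j)) ≡ g (v j)
    step j j≢i = g-edges (punchOut e≢0) (proj₂ v∈old) (proj₁ v∈old)
      where
      e≢0 : zero ≢ e j
      e≢0 0≡eⱼ = j≢i (e-inj (trans (sym 0≡eⱼ) (sym eᵢ≡0)))
      v∈old : v j ∈ E (punchOut e≢0) × v (next j) ∈ E (punchOut e≢0)
      v∈old = subst (λ c → v j ∈ addEdge E f c × v (next j) ∈ addEdge E f c) (sym (punchIn-punchOut e≢0)) (v∈e j)

addEdge-BergeCycle-free : ∀ {n m ℓ b} {B : Set b} {E : Fin m → Subset n} {f : Subset n} (g : Fin n → B) →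
  0 < ℓ → (∀ j → ConstantOn g (E j)) → InjectiveOn g f →
  ¬ HasBergeCycle ℓ E → ¬ HasBergeCycle ℓ (addEdge E f)
addEdge-BergeCycle-free g 0<ℓ g-edges g-f acyclic (v , e , cycle@(v-inj , _)) with any? (λ i → e i ≟ zero)
... | yes (i , eᵢ≡0) = next≢ 0<ℓ i (v-inj (BergeCycle-through-new-edge g g-edges g-f cycle i eᵢ≡0))
... | no  avoids     = acyclic (BergeCycle-avoiding-new-edge cycle λ i 0≡eᵢ → avoids (i , sym 0≡eᵢ))

addEdge-Linear : ∀ {n m} {E : Fin m → Subset n} {f : Subset n} →
  Linear E → (∀ j → ∣ E j ∩ f ∣ ≤ 1) → Linear (addEdge E f)
addEdge-Linear linear meets zero    zero    0≢0 = contradiction refl 0≢0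
addEdge-Linear linear meets (suc i) (suc j) i≢j = linear i j (i≢j ∘ cong suc)
addEdge-Linear linear meets (suc i) zero    _   = meets i
addEdge-Linear {E = E} {f} linear meets zero (suc j) _ = subst (λ p → ∣ p ∣ ≤ 1) (∩-comm (E j) f) (meets j)

new-edge : ∀ {n m} {E : Fin m → Subset n} {f : Subset n} → (∀ j → ∣ E j ∩ f ∣ ≤ 1) → 1 < ∣ f ∣ → ∀ j → E j ≢ f
new-edge {f = f} meets 1<∣f∣ j Eⱼ≡f = <⇒≱ 1<∣f∣ (subst (λ p → ∣ p ∣ ≤ 1) (trans (cong (_∩ f) Eⱼ≡f) (∩-idem f)) (meets j))

theorem1p2 : (t k n m : ℕ) → (E : Fin m → Subset n) →
    3 ≤ t → 3 ≤ k → k ≤ n →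
    IsLinearUniform k E →
    LinearBergeSaturated k (t ∸ 1) E →
    (n ∸ 1) div (k ∸ 1) ≤ m
theorem1p2 (suc (suc (suc _))) (suc d@(suc (suc _))) (suc n′) m E
           (s≤s (s≤s (s≤s _))) (s≤s (s≤s (s≤s _))) (s≤s _) (_ , uniform , linear) (acyclic , saturated)
  with n′ / d ≤? m
... | yes bound = bound
... | no ¬bound =
  let room = s≤s (≤-trans (*-monoˡ-≤ d (≰⇒> ¬bound)) (m/n*n≤m n′ d))
      g , f , ∣f∣≡k , g-edges , g-f = transversal E uniform room
      meets = λ j → ∣constant∩injective∣≤1 g (g-edges j) g-f
      1<∣f∣ = ≤-trans (s≤s (s≤s z≤n)) (≤-reflexive (sym ∣f∣≡k))
  in contradiction (saturated f ∣f∣≡k (new-edge meets 1<∣f∣) (addEdge-Linear linear meets))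
       (addEdge-BergeCycle-free g (s≤s z≤n) g-edges g-f acyclic)
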